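{- In intuitionistic propositional logic, a formula $A$ is ${\sf par}$-projective if and only if the formula $U\to A$ is projective, where $U$ is the uniform post-interpolant of $A$ with respect to ${\sf par}$.
   Context: The language $\mathcal{L}$ is built from atoms ${\sf var}\cup{\sf par}$ (variables and parameters, disjoint infinite sets) using $\bot,\wedge,\vee,\to$; $\top:=\bot\to\bot$. $\mathcal{L}({\sf par})$ is the set of formulas whose atoms are all parameters. A substitution is a map $\theta:\mathcal{L}\to\mathcal{L}$ commuting with connectives with $\theta(p)=p$ for $p\in{\sf par}$. $\vdash$ is intuitionistic derivability. For $E\in\mathcal{L}({\sf par})$, $A$ is $E$-projective if there is $\theta$ with $A\vdash\theta(a)\leftrightarrow a$ for every atom $a$ and $\vdash\theta(A)\leftrightarrow E$; $A$ is ${\sf par}$-projective if it is $E$-projective for some $E\in\mathcal{L}({\sf par})$, and projective if it is $\top$-projective. The uniform post-interpolant $U$ of $A$ w.r.t. ${\sf par}$ is the formula $U\in\mathcal{L}({\sf par})$ with $\vdash A\to U$ and $\vdash U\to C$ for all $C\in\mathcal{L}({\sf par})$ with $\vdash A\to C$ (it exists for intuitionistic logic). -}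

module Defs where

open import Data.Nat using (ℕ)
open import Data.List using (List; []; _∷_)
open import Data.List.Membership.Propositional using (_∈_)
open import Data.Product using (Σ; _×_; _,_)
open import Data.Unit using (⊤)

data Atom : Set where
  var : ℕ → Atom
  par : ℕ → Atom

infixr 6 _∧′_
infixr 5 _∨′_
infixr 4 _⇒_
data Fm : Set where
  at   : Atom → Fm
  ⊥′   : Fm
  _∧′_ : Fm → Fm → Fm
  _∨′_ : Fm → Fm → Fm
  _⇒_  : Fm → Fm → Fm

⊤′ : Fm
⊤′ = ⊥′ ⇒ ⊥′

_⇔_ : Fm → Fm → Fm
A ⇔ B = (A ⇒ B) ∧′ (B ⇒ A)

data IsPar : Fm → Set where
  par-at : ∀ n → IsPar (at (par n))
  par-⊥  : IsPar ⊥′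
  par-∧  : ∀ {A B} → IsPar A → IsPar B → IsPar (A ∧′ B)
  par-∨  : ∀ {A B} → IsPar A → IsPar B → IsPar (A ∨′ B)
  par-⇒  : ∀ {A B} → IsPar A → IsPar B → IsPar (A ⇒ B)

infix 2 _⊢_
data _⊢_ (Γ : List Fm) : Fm → Set where
  hyp  : ∀ {A} → A ∈ Γ → Γ ⊢ A
  ⊥E   : ∀ {A} → Γ ⊢ ⊥′ → Γ ⊢ A
  ∧I   : ∀ {A B} → Γ ⊢ A → Γ ⊢ B → Γ ⊢ A ∧′ B
  ∧E₁  : ∀ {A B} → Γ ⊢ A ∧′ B → Γ ⊢ A
  ∧E₂  : ∀ {A B} → Γ ⊢ A ∧′ B → Γ ⊢ B
  ∨I₁  : ∀ {A B} → Γ ⊢ A → Γ ⊢ A ∨′ B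
  ∨I₂  : ∀ {A B} → Γ ⊢ B → Γ ⊢ A ∨′ B
  ∨E   : ∀ {A B C} → Γ ⊢ A ∨′ B → (A ∷ Γ) ⊢ C → (B ∷ Γ) ⊢ C → Γ ⊢ C
  ⇒I   : ∀ {A B} → (A ∷ Γ) ⊢ B → Γ ⊢ A ⇒ B
  ⇒E   : ∀ {A B} → Γ ⊢ A ⇒ B → Γ ⊢ A → Γ ⊢ B

Subst : Set
Subst = ℕ → Fm

substAt : Subst → Atom → Fm
substAt θ (var n) = θ n
substAt θ (par n) = at (par n)

sub : Subst → Fm → Fm
sub θ (at a)   = substAt θ a
sub θ ⊥′       = ⊥′
sub θ (A ∧′ B) = sub θ A ∧′ sub θ B
sub θ (A ∨′ B) = sub θ A ∨′ sub θ B
sub θ (A ⇒ B)  = sub θ A ⇒ sub θ B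

IsEProjective : Fm → Fm → Set
IsEProjective E A =
  Σ Subst λ θ → ((a : Atom) → (A ∷ []) ⊢ sub θ (at a) ⇔ at a)
              × ([] ⊢ sub θ A ⇔ E)

IsParProjective : Fm → Set
IsParProjective A = Σ Fm λ E → IsPar E × IsEProjective E A

IsProjective : Fm → Set
IsProjective A = IsEProjective ⊤′ A

IsUniformPostInterpolant : Fm → Fm → Set
IsUniformPostInterpolant A U =
  IsPar U × ([] ⊢ A ⇒ U)
  × ((C : Fm) → IsPar C → [] ⊢ A ⇒ C → [] ⊢ U ⇒ C)

-- If θ is an E-projection of A and ⊢ U → E, then σ(x) := (U → θ x) ∧ (U ∨ x) is a projection
-- of U → A: under U it agrees with θ, so σ(U → A) is provable, and under U → A it agrees with
-- the identity, because then U yields A and A makes θ x equivalent to x.  Conversely a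
-- projection of U → A is a U-projection of A, since ⊢ σ A → U for every σ.  The uniform
-- post-interpolant U of an E-projective A satisfies ⊢ U → E because A ⊢ E.
module Submission where

open import Defs
open import Data.Product using (_×_; _,_)
open import Data.List using (List; []; _∷_; map)
open import Data.List.Membership.Propositional using (_∈_)
open import Data.List.Membership.Propositional.Properties using (∈-map⁺)
open import Data.List.Relation.Unary.Any using (here; there)
open import Relation.Binary.PropositionalEquality using (_≡_; refl; sym; subst; cong₂)

_⊆_ : List Fm → List Fm → Set
Γ ⊆ Δ = ∀ {B} → B ∈ Γ → B ∈ Δ

⊆-extend : ∀ {Γ Δ C} → Γ ⊆ Δ → (C ∷ Γ) ⊆ (C ∷ Δ)
⊆-extend Γ⊆Δ (here p)  = here p
⊆-extend Γ⊆Δ (there p) = there (Γ⊆Δ p)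

⊢-mono : ∀ {Γ Δ B} → Γ ⊆ Δ → Γ ⊢ B → Δ ⊢ B
⊢-mono Γ⊆Δ (hyp x)    = hyp (Γ⊆Δ x)
⊢-mono Γ⊆Δ (⊥E d)     = ⊥E (⊢-mono Γ⊆Δ d)
⊢-mono Γ⊆Δ (∧I d e)   = ∧I (⊢-mono Γ⊆Δ d) (⊢-mono Γ⊆Δ e)
⊢-mono Γ⊆Δ (∧E₁ d)    = ∧E₁ (⊢-mono Γ⊆Δ d)
⊢-mono Γ⊆Δ (∧E₂ d)    = ∧E₂ (⊢-mono Γ⊆Δ d)
⊢-mono Γ⊆Δ (∨I₁ d)    = ∨I₁ (⊢-mono Γ⊆Δ d)
⊢-mono Γ⊆Δ (∨I₂ d)    = ∨I₂ (⊢-mono Γ⊆Δ d)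
⊢-mono Γ⊆Δ (∨E d e f) = ∨E (⊢-mono Γ⊆Δ d) (⊢-mono (⊆-extend Γ⊆Δ) e) (⊢-mono (⊆-extend Γ⊆Δ) f)
⊢-mono Γ⊆Δ (⇒I d)     = ⇒I (⊢-mono (⊆-extend Γ⊆Δ) d)
⊢-mono Γ⊆Δ (⇒E d e)   = ⇒E (⊢-mono Γ⊆Δ d) (⊢-mono Γ⊆Δ e)

⊢-weaken : ∀ {Γ B C} → Γ ⊢ B → (C ∷ Γ) ⊢ B
⊢-weaken = ⊢-mono there

⊢-closed : ∀ {Γ B} → [] ⊢ B → Γ ⊢ B
⊢-closed = ⊢-mono (λ ())

⊢-cut : ∀ {Γ B C} → (B ∷ []) ⊢ C → Γ ⊢ B → Γ ⊢ C
⊢-cut d b = ⇒E (⊢-closed (⇒I d)) b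

hyp₀ : ∀ {Γ B} → (B ∷ Γ) ⊢ B
hyp₀ = hyp (here refl)

hyp₁ : ∀ {Γ B C} → (C ∷ B ∷ Γ) ⊢ B
hyp₁ = hyp (there (here refl))

hyp₂ : ∀ {Γ B C D} → (D ∷ C ∷ B ∷ Γ) ⊢ B
hyp₂ = hyp (there (there (here refl)))

⇔-to : ∀ {Γ B C} → Γ ⊢ B ⇔ C → Γ ⊢ B → Γ ⊢ C
⇔-to e b = ⇒E (∧E₁ e) b

⇔-from : ∀ {Γ B C} → Γ ⊢ B ⇔ C → Γ ⊢ C → Γ ⊢ B
⇔-from e c = ⇒E (∧E₂ e) c

⇔-refl : ∀ {Γ B} → Γ ⊢ B ⇔ B
⇔-refl = ∧I (⇒I hyp₀) (⇒I hyp₀)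

⇔-sym : ∀ {Γ B C} → Γ ⊢ B ⇔ C → Γ ⊢ C ⇔ B
⇔-sym e = ∧I (∧E₂ e) (∧E₁ e)

∧-mono : ∀ {Γ B B′ C C′} → Γ ⊢ B ⇔ B′ → Γ ⊢ C ⇔ C′ → Γ ⊢ B ∧′ C ⇒ B′ ∧′ C′
∧-mono eB eC = ⇒I (∧I (⇔-to (⊢-weaken eB) (∧E₁ hyp₀)) (⇔-to (⊢-weaken eC) (∧E₂ hyp₀)))

∨-mono : ∀ {Γ B B′ C C′} → Γ ⊢ B ⇔ B′ → Γ ⊢ C ⇔ C′ → Γ ⊢ B ∨′ C ⇒ B′ ∨′ C′
∨-mono eB eC = ⇒I (∨E hyp₀ (∨I₁ (⇔-to (⊢-weaken (⊢-weaken eB)) hyp₀))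
                           (∨I₂ (⇔-to (⊢-weaken (⊢-weaken eC)) hyp₀)))

⇒-mono : ∀ {Γ B B′ C C′} → Γ ⊢ B ⇔ B′ → Γ ⊢ C ⇔ C′ → Γ ⊢ (B ⇒ C) ⇒ (B′ ⇒ C′)
⇒-mono eB eC = ⇒I (⇒I (⇔-to (⊢-weaken (⊢-weaken eC))
                             (⇒E hyp₁ (⇔-from (⊢-weaken (⊢-weaken eB)) hyp₀))))

∧-cong : ∀ {Γ B B′ C C′} → Γ ⊢ B ⇔ B′ → Γ ⊢ C ⇔ C′ → Γ ⊢ (B ∧′ C) ⇔ (B′ ∧′ C′)
∧-cong eB eC = ∧I (∧-mono eB eC) (∧-mono (⇔-sym eB) (⇔-sym eC))

∨-cong : ∀ {Γ B B′ C C′} → Γ ⊢ B ⇔ B′ → Γ ⊢ C ⇔ C′ → Γ ⊢ (B ∨′ C) ⇔ (B′ ∨′ C′)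
∨-cong eB eC = ∧I (∨-mono eB eC) (∨-mono (⇔-sym eB) (⇔-sym eC))

⇒-cong : ∀ {Γ B B′ C C′} → Γ ⊢ B ⇔ B′ → Γ ⊢ C ⇔ C′ → Γ ⊢ (B ⇒ C) ⇔ (B′ ⇒ C′)
⇒-cong eB eC = ∧I (⇒-mono eB eC) (⇒-mono (⇔-sym eB) (⇔-sym eC))

idSubst : Subst
idSubst n = at (var n)

sub-id : ∀ B → sub idSubst B ≡ B
sub-id (at (var n)) = refl
sub-id (at (par n)) = refl
sub-id ⊥′           = refl
sub-id (B ∧′ C)     = cong₂ _∧′_ (sub-id B) (sub-id C)
sub-id (B ∨′ C)     = cong₂ _∨′_ (sub-id B) (sub-id C)
sub-id (B ⇒ C)      = cong₂ _⇒_ (sub-id B) (sub-id C)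

sub-par : ∀ θ {B} → IsPar B → sub θ B ≡ B
sub-par θ (par-at n)  = refl
sub-par θ par-⊥       = refl
sub-par θ (par-∧ p q) = cong₂ _∧′_ (sub-par θ p) (sub-par θ q)
sub-par θ (par-∨ p q) = cong₂ _∨′_ (sub-par θ p) (sub-par θ q)
sub-par θ (par-⇒ p q) = cong₂ _⇒_ (sub-par θ p) (sub-par θ q)

⊢-sub : ∀ θ {Γ B} → Γ ⊢ B → map (sub θ) Γ ⊢ sub θ B
⊢-sub θ (hyp x)    = hyp (∈-map⁺ (sub θ) x)
⊢-sub θ (⊥E d)     = ⊥E (⊢-sub θ d)
⊢-sub θ (∧I d e)   = ∧I (⊢-sub θ d) (⊢-sub θ e)
⊢-sub θ (∧E₁ d)    = ∧E₁ (⊢-sub θ d)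
⊢-sub θ (∧E₂ d)    = ∧E₂ (⊢-sub θ d)
⊢-sub θ (∨I₁ d)    = ∨I₁ (⊢-sub θ d)
⊢-sub θ (∨I₂ d)    = ∨I₂ (⊢-sub θ d)
⊢-sub θ (∨E d e f) = ∨E (⊢-sub θ d) (⊢-sub θ e) (⊢-sub θ f)
⊢-sub θ (⇒I d)     = ⇒I (⊢-sub θ d)
⊢-sub θ (⇒E d e)   = ⇒E (⊢-sub θ d) (⊢-sub θ e)

⊢-sub-closed⇒par : ∀ θ {B C} → IsPar C → [] ⊢ B ⇒ C → [] ⊢ sub θ B ⇒ C
⊢-sub-closed⇒par θ {B} pC d = subst (λ X → [] ⊢ sub θ B ⇒ X) (sub-par θ pC) (⊢-sub θ d)

sub-cong : ∀ {Γ} σ τ → (∀ a → Γ ⊢ sub σ (at a) ⇔ sub τ (at a)) →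
           ∀ B → Γ ⊢ sub σ B ⇔ sub τ B
sub-cong σ τ eq (at a)   = eq a
sub-cong σ τ eq ⊥′       = ⇔-refl
sub-cong σ τ eq (B ∧′ C) = ∧-cong (sub-cong σ τ eq B) (sub-cong σ τ eq C)
sub-cong σ τ eq (B ∨′ C) = ∨-cong (sub-cong σ τ eq B) (sub-cong σ τ eq C)
sub-cong σ τ eq (B ⇒ C)  = ⇒-cong (sub-cong σ τ eq B) (sub-cong σ τ eq C)

sub-fixes : ∀ {Γ} θ → (∀ a → Γ ⊢ sub θ (at a) ⇔ at a) → ∀ B → Γ ⊢ sub θ B ⇔ B
sub-fixes θ fix B = subst (λ X → _ ⊢ sub θ B ⇔ X) (sub-id B)
  (sub-cong θ idSubst (λ { (var n) → fix (var n) ; (par n) → fix (par n) }) B)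

EProjective⇒⊢⇒ : ∀ {E A} → IsEProjective E A → [] ⊢ A ⇒ E
EProjective⇒⊢⇒ {A = A} (θ , fix , θA⇔E) =
  ⇒I (⇔-to (⊢-closed θA⇔E) (⇔-from (sub-fixes θ fix A) hyp₀))

projective-⇒ : ∀ {E A U} → IsPar U → [] ⊢ U ⇒ E → IsEProjective E A → IsProjective (U ⇒ A)
projective-⇒ {A = A} {U} pU U⇒E (θ , fix , θA⇔E) = σ , σ-fix , σ[U⇒A]⇔⊤
  where
  σ : Subst
  σ n = (U ⇒ θ n) ∧′ (U ∨′ at (var n))

  σ≈θ-under-U : ∀ a → (U ∷ []) ⊢ sub σ (at a) ⇔ sub θ (at a)
  σ≈θ-under-U (par n) = ⇔-refl
  σ≈θ-under-U (var n) = ∧I (⇒I (⇒E (∧E₁ hyp₀) hyp₁)) (⇒I (∧I (⇒I hyp₁) (∨I₁ hyp₁)))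

  σA-under-U : (U ∷ []) ⊢ sub σ A
  σA-under-U = ⇔-from (sub-cong σ θ σ≈θ-under-U A)
                      (⇔-from (⊢-closed θA⇔E) (⇒E (⊢-closed U⇒E) hyp₀))

  σ[U⇒A]⇔⊤ : [] ⊢ sub σ (U ⇒ A) ⇔ ⊤′
  σ[U⇒A]⇔⊤ = ∧I (⇒I (⇒I hyp₀))
    (subst (λ X → [] ⊢ ⊤′ ⇒ (X ⇒ sub σ A)) (sym (sub-par σ pU)) (⇒I (⊢-closed (⇒I σA-under-U))))

  σ-fix : ∀ a → ((U ⇒ A) ∷ []) ⊢ sub σ (at a) ⇔ at a
  σ-fix (par n) = ⇔-refl
  σ-fix (var n) = ∧I
    (⇒I (∨E (∧E₂ hyp₀) (⇔-to (θx⇔x hyp₂ hyp₀) (⇒E (∧E₁ hyp₁) hyp₀)) hyp₀))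
    (⇒I (∧I (⇒I (⇔-from (θx⇔x hyp₂ hyp₀) hyp₁)) (∨I₂ hyp₀)))
    where
    θx⇔x : ∀ {Γ} → Γ ⊢ U ⇒ A → Γ ⊢ U → Γ ⊢ θ n ⇔ at (var n)
    θx⇔x U⇒A u = ⊢-cut (fix (var n)) (⇒E U⇒A u)

projective-⇒⇒EProjective : ∀ {A U} → IsPar U → [] ⊢ A ⇒ U →
                           IsProjective (U ⇒ A) → IsEProjective U A
projective-⇒⇒EProjective {A} {U} pU A⇒U (σ , fix , σ[U⇒A]⇔⊤) =
  σ , (λ a → ⊢-cut (fix a) (⇒I hyp₁)) , ∧I (⊢-sub-closed⇒par σ pU A⇒U) U⇒σA
  where
  U⇒σA : [] ⊢ U ⇒ sub σ A
  U⇒σA = subst (λ X → [] ⊢ X ⇒ sub σ A) (sub-par σ pU) (⇔-from σ[U⇒A]⇔⊤ (⇒I hyp₀))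

corollary4p3 : (A U : Fm) → IsUniformPostInterpolant A U →
    (IsParProjective A → IsProjective (U ⇒ A)) × (IsProjective (U ⇒ A) → IsParProjective A)
corollary4p3 A U (pU , A⇒U , U-strongest) =
  (λ { (E , pE , projE) → projective-⇒ pU (U-strongest E pE (EProjective⇒⊢⇒ projE)) projE }) ,
  (λ proj → U , pU , projective-⇒⇒EProjective pU A⇒U proj)
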